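{- Let $R,\Lambda$ be positive integers and let $x,w$ be integers with $w\ge1$. Suppose there exists a $\mathrm{DK}(R,\Lambda)$-design on $V$ points with $B$ blocks such that the size of every block is congruent to $x$ modulo $w$. Then there exists a set $\mathcal{F}$ of $V$ mutually orthogonal binary frequency squares of type $(B+VR;\,B+VR-R,\,R)$ whose $\mathbb{Z}_w$-sum is equal to $$\begin{bmatrix} xJ_B & 0\\ 0 & J_{VR}\end{bmatrix},$$ where $J_m$ denotes the $m\times m$ all-ones matrix and $0$ denotes zero blocks of appropriate sizes.
   Context: A design is a pair $(\mathcal{V},\mathcal{B})$ with $\mathcal{V}$ a finite set of points and $\mathcal{B}$ a collection (multiset; repeated and empty blocks allowed) of subsets of $\mathcal{V}$. A $\mathrm{DK}(R,\Lambda)$-design is a design in which every pair of distinct points occurs in exactly $\Lambda$ blocks, every point occurs in exactly $R$ blocks, and $R^2=\Lambda|\mathcal{B}|$. A binary frequency square of type $(N;\lambda_0,\lambda_1)$ is an $N\times N$ $(0,1)$-matrix with exactly $\lambda_0$ zeros and $\lambda_1$ ones in each row and column; two such squares of the same type are orthogonal if exactly $\lambda_1^2$ cells contain $1$ in both; mutually orthogonal means pairwise orthogonal. The $\mathbb{Z}_w$-sum of a set of squares is their entrywise sum reduced modulo $w$. -}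

module Defs where

open import Data.Nat using (ℕ; zero; suc; _+_; _*_; _^_; _∸_)
open import Data.Bool using (Bool; true; false; if_then_else_; _∧_)
open import Data.Fin using (Fin; splitAt)
import Data.Fin as Fin
open import Data.Sum using (_⊎_; inj₁; inj₂)
open import Data.Product using (_×_)
open import Data.Integer as ℤ using (ℤ; +_; _-_)
open import Data.Integer.Divisibility using () renaming (_∣_ to _∣ℤ_)
open import Relation.Binary.PropositionalEquality using (_≡_; _≢_)

count : ∀ {n} → (Fin n → Bool) → ℕ
count {zero}  f = 0
count {suc n} f = (if f Fin.zero then 1 else 0) + count (λ i → f (Fin.suc i))

sumℤ : ∀ {n} → (Fin n → ℤ) → ℤ
sumℤ {zero}  f = + 0
sumℤ {suc n} f = f Fin.zero ℤ.+ sumℤ (λ i → f (Fin.suc i))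

_≡_[mod_] : ℤ → ℤ → ℕ → Set
a ≡ b [mod w ] = (+ w) ∣ℤ (a - b)

-- A design on V points with B blocks: an indexed family of B blocks
-- (so repeated/empty blocks are allowed), given by its incidence:
-- incidence b p = true iff point p lies in block b.
Design : ℕ → ℕ → Set
Design V B = Fin B → Fin V → Bool

blockSize : ∀ {V B} → Design V B → Fin B → ℕ
blockSize D b = count (D b)

replication : ∀ {V B} → Design V B → Fin V → ℕ
replication D p = count (λ b → D b p)

pairCount : ∀ {V B} → Design V B → Fin V → Fin V → ℕ
pairCount D p q = count (λ b → D b p ∧ D b q)

record IsDK {V B : ℕ} (R Λ : ℕ) (D : Design V B) : Set where
  field
    pairs  : ∀ p q → p ≢ q → pairCount D p q ≡ Λ
    points : ∀ p → replication D p ≡ R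
    fisher : R ^ 2 ≡ Λ * B

BinSquare : ℕ → Set
BinSquare N = Fin N → Fin N → Bool

not? : Bool → Bool
not? true = false
not? false = true

record IsBFS {N : ℕ} (λ0 λ1 : ℕ) (S : BinSquare N) : Set where
  field
    rowOnes  : ∀ i → count (λ j → S i j) ≡ λ1
    rowZeros : ∀ i → count (λ j → not? (S i j)) ≡ λ0
    colOnes  : ∀ j → count (λ i → S i j) ≡ λ1
    colZeros : ∀ j → count (λ i → not? (S i j)) ≡ λ0

sumℕ : ∀ {n} → (Fin n → ℕ) → ℕ
sumℕ {zero}  f = 0
sumℕ {suc n} f = f Fin.zero + sumℕ (λ i → f (Fin.suc i))

commonOnes : ∀ {N} → BinSquare N → BinSquare N → ℕ
commonOnes S T = sumℕ (λ i → count (λ j → S i j ∧ T i j))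

Orthogonal : ∀ {N} (λ1 : ℕ) → BinSquare N → BinSquare N → Set
Orthogonal λ1 S T = commonOnes S T ≡ λ1 ^ 2

IsMOBFS : ∀ {k N} (λ0 λ1 : ℕ) → (Fin k → BinSquare N) → Set
IsMOBFS λ0 λ1 F = (∀ a → IsBFS λ0 λ1 (F a)) × (∀ a b → a ≢ b → Orthogonal λ1 (F a) (F b))

bit : Bool → ℤ
bit true = + 1
bit false = + 0

ZwSumIs : ∀ {k N} (w : ℕ) → (Fin k → BinSquare N) → (Fin N → Fin N → ℤ) → Set
ZwSumIs w F M = ∀ i j → sumℤ (λ a → bit (F a i j)) ≡ M i j [mod w ]

target : (x : ℤ) (B m : ℕ) → Fin (B + m) → Fin (B + m) → ℤ
target x B m i j with splitAt B i | splitAt B j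
... | inj₁ _ | inj₁ _ = x
... | inj₂ _ | inj₂ _ = + 1
... | _      | _      = + 0

{-# OPTIONS --safe #-}
-- Let ⊕ be addition modulo n on Fin n, a symmetric Latin square.
-- The square of point p has a 1 at (b, b') of its B × B corner iff p lies in
-- block b ⊕ b', and a 1 at (k, l) of its VR × VR corner iff
-- band k ⊕ band l = p, the rows and columns of that corner being grouped into
-- V bands of R.  A row of the first corner meets every block once, so it holds
-- R ones and two squares share Λ ones in it; the second corners also hold R
-- ones per row but are pairwise disjoint.  Hence two squares share BΛ = R² ones.
-- Summed over p, cell (b, b') counts the points of block b ⊕ b', which is x
-- modulo w, and each cell of the second corner is covered by exactly one p.
module Submission where

open import Defs
open import Data.Nat using (ℕ; _+_; _*_; _∸_; _≤_)
open import Data.Integer using (ℤ; +_)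
open import Data.Fin using (Fin)
open import Data.Product using (Σ; _×_)

open import Data.Nat using (zero; suc; _^_; NonZero)
open import Data.Nat.Properties
  using (+-assoc; +-comm; +-identityʳ; *-identityʳ; *-zeroʳ; *-comm; *-distribˡ-+;
         m+n∸m≡n; m+[n∸m]≡n; +-suc; <⇒≤; +-0-commutativeMonoid)
open import Data.Nat.DivMod using (_%_; _mod_; %-distribˡ-+; m%n%n≡m%n; [m+n]%n≡m%n; m<n⇒m%n≡m)
open import Data.Nat.Divisibility using (_∣_; _∣0)
open import Data.Integer.Properties using (i≡j⇒i-j≡0; +-identityˡ)
import Data.Integer as ℤ
open import Data.Bool using (Bool; true; false; if_then_else_; _∧_)
open import Data.Fin as Fin using (splitAt; toℕ; quotient; _≟_)
open import Data.Fin.Properties using (toℕ-injective; toℕ<n; toℕ-fromℕ<)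
open import Data.Fin.Permutation using (Permutation; permutation; _⟨$⟩ʳ_)
open import Data.Sum using (_⊎_; inj₁; inj₂; [_,_]′; map₁)
open import Data.Product using (_,_)
open import Data.Empty using (⊥-elim)
open import Function using (const)
open import Relation.Nullary.Decidable using (does; yes; no)
open import Relation.Binary.PropositionalEquality
import Algebra.Properties.CommutativeMonoid.Sum as CommutativeMonoidSum

open ≡-Reasoning

module ℕ-Sum = CommutativeMonoidSum +-0-commutativeMonoid

indicator : Bool → ℕ
indicator b = if b then 1 else 0

count≡sumℕ : ∀ {n} (f : Fin n → Bool) → count f ≡ sumℕ (λ i → indicator (f i))
count≡sumℕ {zero}  f = refl
count≡sumℕ {suc n} f = cong (_+_ (indicator (f Fin.zero))) (count≡sumℕ (λ i → f (Fin.suc i)))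

sumℕ≡sum : ∀ {n} (f : Fin n → ℕ) → sumℕ f ≡ ℕ-Sum.sum f
sumℕ≡sum {zero}  f = refl
sumℕ≡sum {suc n} f = cong (_+_ (f Fin.zero)) (sumℕ≡sum (λ i → f (Fin.suc i)))

sumℕ-cong : ∀ {n} {f g : Fin n → ℕ} → f ≗ g → sumℕ f ≡ sumℕ g
sumℕ-cong {zero}  f≗g = refl
sumℕ-cong {suc n} f≗g = cong₂ _+_ (f≗g Fin.zero) (sumℕ-cong (λ i → f≗g (Fin.suc i)))

sumℕ-const : ∀ n c → sumℕ {n} (const c) ≡ n * c
sumℕ-const zero    c = refl
sumℕ-const (suc n) c = cong (_+_ c) (sumℕ-const n c)

sumℕ-splitAt : ∀ m {n} (h : Fin m ⊎ Fin n → ℕ) →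
  sumℕ (λ i → h (splitAt m i)) ≡ sumℕ (λ b → h (inj₁ b)) + sumℕ (λ l → h (inj₂ l))
sumℕ-splitAt zero    h = refl
sumℕ-splitAt (suc m) h = begin
  h (inj₁ Fin.zero) + sumℕ (λ i → h (map₁ Fin.suc (splitAt m i)))
    ≡⟨ cong (_+_ (h (inj₁ Fin.zero))) (sumℕ-splitAt m (λ s → h (map₁ Fin.suc s))) ⟩
  h (inj₁ Fin.zero) + (sumℕ (λ b → h (inj₁ (Fin.suc b))) + sumℕ (λ l → h (inj₂ l)))
    ≡⟨ sym (+-assoc (h (inj₁ Fin.zero)) _ _) ⟩
  h (inj₁ Fin.zero) + sumℕ (λ b → h (inj₁ (Fin.suc b))) + sumℕ (λ l → h (inj₂ l)) ∎

sumℕ-permute : ∀ {n} (f : Fin n → ℕ) (π : Permutation n n) → sumℕ f ≡ sumℕ (λ i → f (π ⟨$⟩ʳ i))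
sumℕ-permute f π = begin
  sumℕ f                          ≡⟨ sumℕ≡sum f ⟩
  ℕ-Sum.sum f                     ≡⟨ ℕ-Sum.sum-permute f π ⟩
  ℕ-Sum.sum (λ i → f (π ⟨$⟩ʳ i))  ≡⟨ sym (sumℕ≡sum (λ i → f (π ⟨$⟩ʳ i))) ⟩
  sumℕ (λ i → f (π ⟨$⟩ʳ i))       ∎

count-cong : ∀ {n} {f g : Fin n → Bool} → f ≗ g → count f ≡ count g
count-cong {f = f} {g} f≗g = begin
  count f                          ≡⟨ count≡sumℕ f ⟩
  sumℕ (λ i → indicator (f i))     ≡⟨ sumℕ-cong (λ i → cong indicator (f≗g i)) ⟩
  sumℕ (λ i → indicator (g i))     ≡⟨ sym (count≡sumℕ g) ⟩
  count g                          ∎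

count-false : ∀ {n} → count {n} (const false) ≡ 0
count-false {zero}  = refl
count-false {suc n} = count-false {n}

count-const : ∀ n b → count {n} (const b) ≡ n * indicator b
count-const n b = trans (count≡sumℕ {n} (const b)) (sumℕ-const n (indicator b))

count-splitAt : ∀ m {n} (h : Fin m ⊎ Fin n → Bool) →
  count (λ i → h (splitAt m i)) ≡ count (λ b → h (inj₁ b)) + count (λ l → h (inj₂ l))
count-splitAt m h = begin
  count (λ i → h (splitAt m i))
    ≡⟨ count≡sumℕ (λ i → h (splitAt m i)) ⟩
  sumℕ (λ i → indicator (h (splitAt m i)))
    ≡⟨ sumℕ-splitAt m (λ s → indicator (h s)) ⟩
  sumℕ (λ b → indicator (h (inj₁ b))) + sumℕ (λ l → indicator (h (inj₂ l)))
    ≡⟨ sym (cong₂ _+_ (count≡sumℕ (λ b → h (inj₁ b))) (count≡sumℕ (λ l → h (inj₂ l)))) ⟩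
  count (λ b → h (inj₁ b)) + count (λ l → h (inj₂ l)) ∎

count-permute : ∀ {n} (f : Fin n → Bool) (π : Permutation n n) → count f ≡ count (λ i → f (π ⟨$⟩ʳ i))
count-permute f π = begin
  count f                                    ≡⟨ count≡sumℕ f ⟩
  sumℕ (λ i → indicator (f i))               ≡⟨ sumℕ-permute (λ i → indicator (f i)) π ⟩
  sumℕ (λ i → indicator (f (π ⟨$⟩ʳ i)))      ≡⟨ sym (count≡sumℕ (λ i → f (π ⟨$⟩ʳ i))) ⟩
  count (λ i → f (π ⟨$⟩ʳ i))                 ∎

count+count-not? : ∀ {n} (f : Fin n → Bool) → count f + count (λ i → not? (f i)) ≡ n
count+count-not? {zero}  f = refl
count+count-not? {suc n} f with f Fin.zero
... | true  = cong suc (count+count-not? (λ i → f (Fin.suc i)))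
... | false = trans (+-suc (count (λ i → f (Fin.suc i))) _) (cong suc (count+count-not? (λ i → f (Fin.suc i))))

count-not? : ∀ {n} (f : Fin n → Bool) → count (λ i → not? (f i)) ≡ n ∸ count f
count-not? {n} f = begin
  count (λ i → not? (f i))                                ≡⟨ sym (m+n∸m≡n (count f) _) ⟩
  count f + count (λ i → not? (f i)) ∸ count f            ≡⟨ cong (_∸ count f) (count+count-not? f) ⟩
  n ∸ count f                                             ∎

count-≟ˡ : ∀ {n} (p : Fin n) → count (λ c → does (c ≟ p)) ≡ 1
count-≟ˡ {suc n} Fin.zero    = cong suc (count-false {n})
count-≟ˡ {suc n} (Fin.suc p) = count-≟ˡ p

count-≟ʳ : ∀ {n} (p : Fin n) → count (λ c → does (p ≟ c)) ≡ 1
count-≟ʳ {suc n} Fin.zero    = cong suc (count-false {n})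
count-≟ʳ {suc n} (Fin.suc p) = count-≟ʳ p

≟-∧-≟-distinct : ∀ {n} {p q : Fin n} → p ≢ q → ∀ c → (does (c ≟ p) ∧ does (c ≟ q)) ≡ false
≟-∧-≟-distinct {p = p} {q} p≢q c with c ≟ p | c ≟ q
... | no _     | _        = refl
... | yes _    | no _     = refl
... | yes refl | yes refl = ⊥-elim (p≢q refl)

count-quotient : ∀ m n (g : Fin m → Bool) → count (λ k → g (quotient {m} n k)) ≡ n * count g
count-quotient zero    n g = sym (*-zeroʳ n)
count-quotient (suc m) n g = begin
  count (λ k → g (quotient {suc m} n k))
    ≡⟨ count-cong (λ k → cong g (quotient-suc k)) ⟩
  count (λ k → g ([ const Fin.zero , (λ l → Fin.suc (quotient n l)) ]′ (splitAt n k)))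
    ≡⟨ count-splitAt n (λ s → g ([ const Fin.zero , (λ l → Fin.suc (quotient n l)) ]′ s)) ⟩
  count {n} (const (g Fin.zero)) + count (λ l → g (Fin.suc (quotient {m} n l)))
    ≡⟨ cong₂ _+_ (count-const n (g Fin.zero)) (count-quotient m n (λ i → g (Fin.suc i))) ⟩
  n * indicator (g Fin.zero) + n * count (λ i → g (Fin.suc i))
    ≡⟨ sym (*-distribˡ-+ n _ _) ⟩
  n * count g ∎
  where
  quotient-suc : ∀ k → quotient {suc m} n k ≡ [ const Fin.zero , (λ l → Fin.suc (quotient n l)) ]′ (splitAt n k)
  quotient-suc k with splitAt n k
  ... | inj₁ _ = refl
  ... | inj₂ _ = refl

toℕ-mod : ∀ m d .{{_ : NonZero d}} → toℕ (m mod d) ≡ m % d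
toℕ-mod m d = toℕ-fromℕ< _

[m%d+n]%d≡[m+n]%d : ∀ m n d .{{_ : NonZero d}} → (m % d + n) % d ≡ (m + n) % d
[m%d+n]%d≡[m+n]%d m n d = begin
  (m % d + n) % d          ≡⟨ %-distribˡ-+ (m % d) n d ⟩
  (m % d % d + n % d) % d  ≡⟨ cong (λ r → (r + n % d) % d) (m%n%n≡m%n m d) ⟩
  (m % d + n % d) % d      ≡⟨ sym (%-distribˡ-+ m n d) ⟩
  (m + n) % d              ∎

[m+n%d]%d≡[m+n]%d : ∀ m n d .{{_ : NonZero d}} → (m + n % d) % d ≡ (m + n) % d
[m+n%d]%d≡[m+n]%d m n d = begin
  (m + n % d) % d   ≡⟨ cong (_% d) (+-comm m (n % d)) ⟩
  (n % d + m) % d   ≡⟨ [m%d+n]%d≡[m+n]%d n m d ⟩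
  (n + m) % d       ≡⟨ cong (_% d) (+-comm n m) ⟩
  (m + n) % d       ∎

infixl 6 _⊕_ _⊖_

_⊕_ : ∀ {n} → Fin n → Fin n → Fin n
_⊕_ {suc n} a b = (toℕ a + toℕ b) mod suc n

_⊖_ : ∀ {n} → Fin n → Fin n → Fin n
_⊖_ {suc n} c a = (toℕ c + (suc n ∸ toℕ a)) mod suc n

⊕-comm : ∀ {n} (a b : Fin n) → a ⊕ b ≡ b ⊕ a
⊕-comm {suc n} a b = cong (λ k → k mod suc n) (+-comm (toℕ a) (toℕ b))

module _ {n : ℕ} where
  private
    N = suc n

  [a+b+[N∸a]]%N≡b : (a b : Fin N) → (toℕ a + toℕ b + (N ∸ toℕ a)) % N ≡ toℕ b
  [a+b+[N∸a]]%N≡b a b = begin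
    (toℕ a + toℕ b + (N ∸ toℕ a)) % N    ≡⟨ cong (λ r → (r + (N ∸ toℕ a)) % N) (+-comm (toℕ a) (toℕ b)) ⟩
    (toℕ b + toℕ a + (N ∸ toℕ a)) % N    ≡⟨ cong (_% N) (+-assoc (toℕ b) (toℕ a) _) ⟩
    (toℕ b + (toℕ a + (N ∸ toℕ a))) % N  ≡⟨ cong (λ r → (toℕ b + r) % N) (m+[n∸m]≡n (<⇒≤ (toℕ<n a))) ⟩
    (toℕ b + N) % N                      ≡⟨ [m+n]%n≡m%n (toℕ b) N ⟩
    toℕ b % N                            ≡⟨ m<n⇒m%n≡m (toℕ<n b) ⟩
    toℕ b                                ∎

  ⊕-⊖-cancel : (a b : Fin N) → a ⊕ b ⊖ a ≡ b
  ⊕-⊖-cancel a b = toℕ-injective (begin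
    toℕ (a ⊕ b ⊖ a)                                ≡⟨ toℕ-mod (toℕ (a ⊕ b) + (N ∸ toℕ a)) N ⟩
    (toℕ (a ⊕ b) + (N ∸ toℕ a)) % N                ≡⟨ cong (λ r → (r + (N ∸ toℕ a)) % N) (toℕ-mod (toℕ a + toℕ b) N) ⟩
    ((toℕ a + toℕ b) % N + (N ∸ toℕ a)) % N        ≡⟨ [m%d+n]%d≡[m+n]%d (toℕ a + toℕ b) _ N ⟩
    (toℕ a + toℕ b + (N ∸ toℕ a)) % N              ≡⟨ [a+b+[N∸a]]%N≡b a b ⟩
    toℕ b                                          ∎)

  ⊖-⊕-cancel : (a c : Fin N) → a ⊕ (c ⊖ a) ≡ c
  ⊖-⊕-cancel a c = toℕ-injective (begin
    toℕ (a ⊕ (c ⊖ a))                              ≡⟨ toℕ-mod (toℕ a + toℕ (c ⊖ a)) N ⟩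
    (toℕ a + toℕ (c ⊖ a)) % N                      ≡⟨ cong (λ r → (toℕ a + r) % N) (toℕ-mod (toℕ c + (N ∸ toℕ a)) N) ⟩
    (toℕ a + (toℕ c + (N ∸ toℕ a)) % N) % N        ≡⟨ [m+n%d]%d≡[m+n]%d (toℕ a) _ N ⟩
    (toℕ a + (toℕ c + (N ∸ toℕ a))) % N            ≡⟨ cong (_% N) (sym (+-assoc (toℕ a) (toℕ c) _)) ⟩
    (toℕ a + toℕ c + (N ∸ toℕ a)) % N              ≡⟨ [a+b+[N∸a]]%N≡b a c ⟩
    toℕ c                                          ∎)

⊕-permutation : ∀ {n} → Fin n → Permutation n n
⊕-permutation {suc n} a = permutation (a ⊕_) (_⊖ a) (⊖-⊕-cancel a) (⊕-⊖-cancel a)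

count-⊕ : ∀ {n} (a : Fin n) (h : Fin n → Bool) → count (λ b → h (a ⊕ b)) ≡ count h
count-⊕ {suc n} a h = sym (count-permute h (⊕-permutation a))

≡⇒≡[mod] : ∀ {a b : ℤ} {w} → a ≡ b → a ≡ b [mod w ]
≡⇒≡[mod] {a} {b} {w} a≡b = subst (λ d → w ∣ ℤ.∣ d ∣) (sym (i≡j⇒i-j≡0 a≡b)) (w ∣0)

sumℤ-bit : ∀ {n} (f : Fin n → Bool) → sumℤ (λ a → bit (f a)) ≡ + count f
sumℤ-bit {zero}  f = refl
sumℤ-bit {suc n} f with f Fin.zero
... | true  = cong (ℤ._+_ (+ 1)) (sumℤ-bit (λ i → f (Fin.suc i)))
... | false = trans (+-identityˡ _) (sumℤ-bit (λ i → f (Fin.suc i)))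

module Construction {V B : ℕ} (D : Design V B) (R : ℕ) where

  band : Fin (V * R) → Fin V
  band = quotient R

  entry : Fin V → Fin B ⊎ Fin (V * R) → Fin B ⊎ Fin (V * R) → Bool
  entry p (inj₁ b) (inj₁ b') = D (b ⊕ b') p
  entry p (inj₁ b) (inj₂ l)  = false
  entry p (inj₂ k) (inj₁ b') = false
  entry p (inj₂ k) (inj₂ l)  = does (band k ⊕ band l ≟ p)

  square : Fin V → BinSquare (B + V * R)
  square p i j = entry p (splitAt B i) (splitAt B j)

  entry-comm : ∀ p s t → entry p s t ≡ entry p t s
  entry-comm p (inj₁ b) (inj₁ b') = cong (λ c → D c p) (⊕-comm b b')
  entry-comm p (inj₁ b) (inj₂ l)  = refl
  entry-comm p (inj₂ k) (inj₁ b') = refl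
  entry-comm p (inj₂ k) (inj₂ l)  = cong (λ c → does (c ≟ p)) (⊕-comm (band k) (band l))

  entry-rowOnes : (∀ p → replication D p ≡ R) → ∀ p s → count (λ j → entry p s (splitAt B j)) ≡ R
  entry-rowOnes points p (inj₁ b) = begin
    count (λ j → entry p (inj₁ b) (splitAt B j))
      ≡⟨ count-splitAt B (entry p (inj₁ b)) ⟩
    count (λ b' → D (b ⊕ b') p) + count {V * R} (const false)
      ≡⟨ cong₂ _+_ (count-⊕ b (λ c → D c p)) (count-false {V * R}) ⟩
    replication D p + 0
      ≡⟨ +-identityʳ _ ⟩
    replication D p
      ≡⟨ points p ⟩
    R ∎
  entry-rowOnes points p (inj₂ k) = begin
    count (λ j → entry p (inj₂ k) (splitAt B j))
      ≡⟨ count-splitAt B (entry p (inj₂ k)) ⟩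
    count {B} (const false) + count (λ l → does (band k ⊕ band l ≟ p))
      ≡⟨ cong₂ _+_ (count-false {B}) (count-quotient V R (λ c → does (band k ⊕ c ≟ p))) ⟩
    R * count (λ c → does (band k ⊕ c ≟ p))
      ≡⟨ cong (R *_) (trans (count-⊕ (band k) (λ c → does (c ≟ p))) (count-≟ˡ p)) ⟩
    R * 1
      ≡⟨ *-identityʳ R ⟩
    R ∎

  entry-rowZeros : (∀ p → replication D p ≡ R) →
    ∀ p s → count (λ j → not? (entry p s (splitAt B j))) ≡ B + V * R ∸ R
  entry-rowZeros points p s =
    trans (count-not? (λ j → entry p s (splitAt B j))) (cong (B + V * R ∸_) (entry-rowOnes points p s))

  square-isBFS : (∀ p → replication D p ≡ R) → ∀ p → IsBFS (B + V * R ∸ R) R (square p)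
  square-isBFS points p = record
    { rowOnes  = λ i → entry-rowOnes points p (splitAt B i)
    ; rowZeros = λ i → entry-rowZeros points p (splitAt B i)
    ; colOnes  = λ j → trans (count-cong (λ i → entry-comm p (splitAt B i) (splitAt B j)))
                             (entry-rowOnes points p (splitAt B j))
    ; colZeros = λ j → trans (count-cong (λ i → cong not? (entry-comm p (splitAt B i) (splitAt B j))))
                             (entry-rowZeros points p (splitAt B j))
    }

  commonRowOnes : ℕ → Fin B ⊎ Fin (V * R) → ℕ
  commonRowOnes Λ (inj₁ _) = Λ
  commonRowOnes Λ (inj₂ _) = 0

  entry-commonRowOnes : ∀ {Λ p q} → (∀ p q → p ≢ q → pairCount D p q ≡ Λ) → p ≢ q →
    ∀ s → count (λ j → entry p s (splitAt B j) ∧ entry q s (splitAt B j)) ≡ commonRowOnes Λ s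
  entry-commonRowOnes {Λ} {p} {q} pairs p≢q (inj₁ b) = begin
    count (λ j → entry p (inj₁ b) (splitAt B j) ∧ entry q (inj₁ b) (splitAt B j))
      ≡⟨ count-splitAt B (λ t → entry p (inj₁ b) t ∧ entry q (inj₁ b) t) ⟩
    count (λ b' → D (b ⊕ b') p ∧ D (b ⊕ b') q) + count {V * R} (const false)
      ≡⟨ cong₂ _+_ (count-⊕ b (λ c → D c p ∧ D c q)) (count-false {V * R}) ⟩
    pairCount D p q + 0
      ≡⟨ +-identityʳ _ ⟩
    pairCount D p q
      ≡⟨ pairs p q p≢q ⟩
    Λ ∎
  entry-commonRowOnes {Λ} {p} {q} pairs p≢q (inj₂ k) = begin
    count (λ j → entry p (inj₂ k) (splitAt B j) ∧ entry q (inj₂ k) (splitAt B j))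
      ≡⟨ count-splitAt B (λ t → entry p (inj₂ k) t ∧ entry q (inj₂ k) t) ⟩
    count {B} (const false) + count (λ l → does (band k ⊕ band l ≟ p) ∧ does (band k ⊕ band l ≟ q))
      ≡⟨ cong₂ _+_ (count-false {B}) (count-cong (λ l → ≟-∧-≟-distinct p≢q (band k ⊕ band l))) ⟩
    count {V * R} (const false)
      ≡⟨ count-false {V * R} ⟩
    0 ∎

  square-orthogonal : ∀ {Λ} → (∀ p q → p ≢ q → pairCount D p q ≡ Λ) → R ^ 2 ≡ Λ * B →
    ∀ p q → p ≢ q → Orthogonal R (square p) (square q)
  square-orthogonal {Λ} pairs fisher p q p≢q = begin
    sumℕ (λ i → count (λ j → square p i j ∧ square q i j))
      ≡⟨ sumℕ-cong (λ i → entry-commonRowOnes pairs p≢q (splitAt B i)) ⟩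
    sumℕ (λ i → commonRowOnes Λ (splitAt B i))
      ≡⟨ sumℕ-splitAt B (commonRowOnes Λ) ⟩
    sumℕ {B} (const Λ) + sumℕ {V * R} (const 0)
      ≡⟨ cong₂ _+_ (sumℕ-const B Λ) (sumℕ-const (V * R) 0) ⟩
    B * Λ + V * R * 0
      ≡⟨ cong (_+_ (B * Λ)) (*-zeroʳ (V * R)) ⟩
    B * Λ + 0
      ≡⟨ +-identityʳ _ ⟩
    B * Λ
      ≡⟨ *-comm B Λ ⟩
    Λ * B
      ≡⟨ sym fisher ⟩
    R ^ 2 ∎

  square-ZwSum : ∀ {x w} → (∀ b → (+ blockSize D b) ≡ x [mod w ]) → ZwSumIs w square (target x B (V * R))
  square-ZwSum {x} {w} sizes i j with splitAt B i | splitAt B j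
  ... | inj₁ b | inj₁ b' = subst (λ s → s ≡ x [mod w ]) (sym (sumℤ-bit (D (b ⊕ b')))) (sizes (b ⊕ b'))
  ... | inj₁ b | inj₂ l  = ≡⇒≡[mod] (trans (sumℤ-bit {V} (const false)) (cong +_ (count-false {V})))
  ... | inj₂ k | inj₁ b' = ≡⇒≡[mod] (trans (sumℤ-bit {V} (const false)) (cong +_ (count-false {V})))
  ... | inj₂ k | inj₂ l  = ≡⇒≡[mod] (trans (sumℤ-bit (λ p → does (band k ⊕ band l ≟ p)))
                                           (cong +_ (count-≟ʳ (band k ⊕ band l))))

lemma5p1 : (R Λ : ℕ) → 1 ≤ R → 1 ≤ Λ → (x : ℤ) (w : ℕ) → 1 ≤ w →
    (V B : ℕ) (D : Design V B) → IsDK R Λ D →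
    (∀ b → (+ blockSize D b) ≡ x [mod w ]) →
    Σ (Fin V → BinSquare (B + V * R)) (λ F →
      IsMOBFS (B + V * R ∸ R) R F × ZwSumIs w F (target x B (V * R)))
lemma5p1 R Λ _ _ x w _ V B D dk sizes =
  square , (square-isBFS points , square-orthogonal pairs fisher) , square-ZwSum sizes
  where
  open Construction D R
  open IsDK dk
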